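{- For every integer $k\ge 2$, the polynomials $L_k$ satisfy \[ L_k(a_1,\dots,a_k)=a_k\,L_{k-1}(a_1,\dots,a_{k-2},a_{k-1}+1)+L_{k-1}(a_1,\dots,a_{k-1}). \]
   Context: For $k\ge 1$ and variables $a_1,\dots,a_k$, define \[ L_k(a_1,\dots,a_k)=\sum_{\ell=1}^{k}\ \sum_{1\le i_1<\cdots<i_\ell\le k}(i_2-i_1)(i_3-i_2)\cdots(i_\ell-i_{\ell-1})\,a_{i_1}a_{i_2}\cdots a_{i_\ell}, \] where for $\ell=1$ the product of differences is $1$. -}

module Defs where

open import Level using (Level)
open import Algebra.Bundles using (CommutativeRing)
open import Data.Nat using (ℕ; zero; suc; _∸_)
open import Data.Fin using (Fin; zero; suc; toℕ)
open import Data.List using (List; []; _∷_; map; _++_; [_])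
import Algebra.Definitions.RawMonoid as RawMonoidDefs

-- All subsets of {0,…,k-1} (i.e. of {1,…,k} shifted), each listed once as a
-- strictly increasing list of indices (the empty subset included).
subsets : (k : ℕ) → List (List (Fin k))
subsets zero    = [ [] ]
subsets (suc k) = map (map suc) (subsets k) ++ map (λ s → zero ∷ map suc s) (subsets k)

module _ {c ℓ : Level} (R : CommutativeRing c ℓ) where
  open CommutativeRing R
  open RawMonoidDefs +-rawMonoid using (_×_)

  -- term of a subset i₁<…<i_ℓ : (i₂-i₁)⋯(i_ℓ-i_{ℓ-1}) a_{i₁}⋯a_{i_ℓ};
  -- the empty subset (not part of the sum, ℓ ≥ 1) contributes 0.
  term : {k : ℕ} → (Fin k → Carrier) → List (Fin k) → Carrier
  term a []           = 0#
  term a (i ∷ [])     = a i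
  term a (i ∷ j ∷ s)  = ((toℕ j ∸ toℕ i) × a i) * term a (j ∷ s)

  sumR : List Carrier → Carrier
  sumR []       = 0#
  sumR (x ∷ xs) = x + sumR xs

  -- L_k(a₁,…,a_k), variables indexed by Fin k (a (i) = a_{i+1})
  L : (k : ℕ) → (Fin k → Carrier) → Carrier
  L k a = sumR (map (term a) (subsets k))

-- Writing ∂L k a for the coefficient of a new first variable x in L (suc k) (x ∷ a),
-- splitting the subsets of {0,…,k} by whether they contain 0 gives
--   L (suc k) (x ∷ a) = L k a + x · ∂L k a,
--   ∂L (suc k) (x ∷ a) = (∂L k a + L k a) + x · ∂L k a,
-- the second because shifting a subset up by one raises its weight i₁ by one.
-- Both right-hand sides only involve the first variable, while the recurrence acts on the
-- last one; so if L and ∂L satisfy the recurrence at length k + 1, they do at length k + 2.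
-- The induction starts from a direct computation at length 2.
module Submission where

open import Defs
open import Level using (Level; _⊔_)
open import Algebra.Bundles using (CommutativeRing)
open import Data.Nat using (ℕ; suc)
open import Data.Fin using (Fin; zero; suc; fromℕ; toℕ)
open import Data.List using (List; []; _∷_; map; _++_)
open import Data.List.Properties using (map-++; map-∘)
open import Data.Vec.Functional using (updateAt; init; last; tail)
open import Relation.Binary.PropositionalEquality as ≡ using (_≡_)
open import Tactic.RingSolver.Core.AlmostCommutativeRing using (fromCommutativeRing)
open import Data.Maybe using (nothing)
import Algebra.Properties.Semiring.Mult as SemiringMult
import Relation.Binary.Reasoning.Setoid as SetoidReasoning

module _ {c ℓ : Level} (R : CommutativeRing c ℓ) where
  open CommutativeRing R hiding (zero)
  open SemiringMult semiring using (_×_; ×-assoc-*; ×-comm-*)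
  open import Tactic.RingSolver.NonReflective (fromCommutativeRing R (λ _ → nothing))
  open SetoidReasoning setoid

  sumR-++ : (xs ys : List Carrier) → sumR R (xs ++ ys) ≈ sumR R xs + sumR R ys
  sumR-++ []       ys = sym (+-identityˡ _)
  sumR-++ (x ∷ xs) ys = trans (+-congˡ (sumR-++ xs ys)) (sym (+-assoc _ _ _))

  sumR-map-cong : {A : Set} {f g : A → Carrier} → (∀ x → f x ≈ g x) →
                  (xs : List A) → sumR R (map f xs) ≈ sumR R (map g xs)
  sumR-map-cong f≈g []       = refl
  sumR-map-cong f≈g (x ∷ xs) = +-cong (f≈g x) (sumR-map-cong f≈g xs)

  sumR-map-+ : {A : Set} (f g : A → Carrier) (xs : List A) →
               sumR R (map (λ x → f x + g x) xs) ≈ sumR R (map f xs) + sumR R (map g xs)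
  sumR-map-+ f g []       = sym (+-identityˡ _)
  sumR-map-+ f g (x ∷ xs) = trans (+-congˡ (sumR-map-+ f g xs))
    (solve 4 (λ a b c d → ((a ⊕ b) ⊕ (c ⊕ d)) ⊜ ((a ⊕ c) ⊕ (b ⊕ d))) refl _ _ _ _)

  sumR-map-*ˡ : {A : Set} (y : Carrier) (f : A → Carrier) (xs : List A) →
                sumR R (map (λ x → y * f x) xs) ≈ y * sumR R (map f xs)
  sumR-map-*ˡ y f []       = sym (zeroʳ y)
  sumR-map-*ˡ y f (x ∷ xs) = trans (+-congˡ (sumR-map-*ˡ y f xs)) (sym (distribˡ _ _ _))

  sumR-subsets-suc : {k : ℕ} (f : List (Fin (suc k)) → Carrier) →
    sumR R (map f (subsets (suc k))) ≈
    sumR R (map (λ s → f (map suc s)) (subsets k)) + sumR R (map (λ s → f (zero ∷ map suc s)) (subsets k))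
  sumR-subsets-suc {k} f = begin
    sumR R (map f (map (map suc) S ++ map (λ s → zero ∷ map suc s) S))
      ≡⟨ ≡.cong (sumR R) (map-++ f (map (map suc) S) _) ⟩
    sumR R (map f (map (map suc) S) ++ map f (map (λ s → zero ∷ map suc s) S))
      ≈⟨ sumR-++ (map f (map (map suc) S)) _ ⟩
    sumR R (map f (map (map suc) S)) + sumR R (map f (map (λ s → zero ∷ map suc s) S))
      ≡⟨ ≡.sym (≡.cong₂ (λ xs ys → sumR R xs + sumR R ys) (map-∘ S) (map-∘ S)) ⟩
    sumR R (map (λ s → f (map suc s)) S) + sumR R (map (λ s → f (zero ∷ map suc s)) S) ∎
    where S = subsets k

  term-map-suc : {k : ℕ} (a : Fin (suc k) → Carrier) (s : List (Fin k)) →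
                 term R a (map suc s) ≡ term R (tail a) s
  term-map-suc a []          = ≡.refl
  term-map-suc a (i ∷ [])    = ≡.refl
  term-map-suc a (i ∷ j ∷ s) = ≡.cong (_ *_) (term-map-suc a (j ∷ s))

  firstWeighted : {k : ℕ} → (Fin k → Carrier) → List (Fin k) → Carrier
  firstWeighted a []      = 1#
  firstWeighted a (i ∷ s) = suc (toℕ i) × term R a (i ∷ s)

  ∂L : (k : ℕ) → (Fin k → Carrier) → Carrier
  ∂L k a = sumR R (map (firstWeighted a) (subsets k))

  term-zero∷ : {k : ℕ} (a : Fin (suc k) → Carrier) (s : List (Fin k)) →
               term R a (zero ∷ map suc s) ≈ a zero * firstWeighted (tail a) s
  term-zero∷ a []      = sym (*-identityʳ _)
  term-zero∷ a (j ∷ s) = begin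
    (suc (toℕ j) × a zero) * term R a (map suc (j ∷ s)) ≡⟨ ≡.cong (_ *_) (term-map-suc a (j ∷ s)) ⟩
    (suc (toℕ j) × a zero) * term R (tail a) (j ∷ s)    ≈⟨ ×-assoc-* (suc (toℕ j)) _ _ ⟩
    suc (toℕ j) × (a zero * term R (tail a) (j ∷ s))    ≈⟨ sym (×-comm-* (suc (toℕ j)) _ _) ⟩
    a zero * firstWeighted (tail a) (j ∷ s)             ∎

  firstWeighted-map-suc : {k : ℕ} (a : Fin (suc k) → Carrier) (s : List (Fin k)) →
    firstWeighted a (map suc s) ≈ firstWeighted (tail a) s + term R (tail a) s
  firstWeighted-map-suc a []      = sym (+-identityʳ 1#)
  firstWeighted-map-suc a (i ∷ s) = begin
    suc (suc (toℕ i)) × term R a (map suc (i ∷ s)) ≡⟨ ≡.cong (suc (suc (toℕ i)) ×_) (term-map-suc a (i ∷ s)) ⟩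
    T + suc (toℕ i) × T                            ≈⟨ +-comm _ _ ⟩
    suc (toℕ i) × T + T                            ∎
    where T = term R (tail a) (i ∷ s)

  sumR-term-zero∷ : (k : ℕ) (a : Fin (suc k) → Carrier) →
    sumR R (map (λ s → term R a (zero ∷ map suc s)) (subsets k)) ≈ a zero * ∂L k (tail a)
  sumR-term-zero∷ k a =
    trans (sumR-map-cong (term-zero∷ a) (subsets k)) (sumR-map-*ˡ (a zero) _ (subsets k))

  L-suc : (k : ℕ) (a : Fin (suc k) → Carrier) → L R (suc k) a ≈ L R k (tail a) + a zero * ∂L k (tail a)
  L-suc k a = trans (sumR-subsets-suc (term R a))
    (+-cong (sumR-map-cong (λ s → reflexive (term-map-suc a s)) (subsets k)) (sumR-term-zero∷ k a))

  ∂L-suc : (k : ℕ) (a : Fin (suc k) → Carrier) →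
           ∂L (suc k) a ≈ (∂L k (tail a) + L R k (tail a)) + a zero * ∂L k (tail a)
  ∂L-suc k a = trans (sumR-subsets-suc (firstWeighted a))
    (+-cong (trans (sumR-map-cong (firstWeighted-map-suc a) S) (sumR-map-+ _ _ S))
            (trans (sumR-map-cong (λ s → +-identityʳ _) S) (sumR-term-zero∷ k a)))
    where S = subsets k

  L-zero : (a : Fin 0 → Carrier) → L R 0 a ≈ 0#
  L-zero a = +-identityʳ 0#

  ∂L-zero : (a : Fin 0 → Carrier) → ∂L 0 a ≈ 1#
  ∂L-zero a = +-identityʳ 1#

  L-one : (a : Fin 1 → Carrier) → L R 1 a ≈ a zero
  L-one a = trans (L-suc 0 a) (trans (+-cong (L-zero (tail a)) (*-congˡ (∂L-zero (tail a))))
                                     (trans (+-identityˡ _) (*-identityʳ _)))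

  ∂L-one : (a : Fin 1 → Carrier) → ∂L 1 a ≈ 1# + a zero
  ∂L-one a = trans (∂L-suc 0 a) (+-cong (trans (+-cong (∂L-zero (tail a)) (L-zero (tail a))) (+-identityʳ 1#))
                                        (trans (*-congˡ (∂L-zero (tail a))) (*-identityʳ _)))

  incrementLast : (n : ℕ) → (Fin (suc n) → Carrier) → Fin (suc n) → Carrier
  incrementLast n a = updateAt a (fromℕ n) (λ x → x + 1#)

  LastRecurrence : ((k : ℕ) → (Fin k → Carrier) → Carrier) → ℕ → Set (c ⊔ ℓ)
  LastRecurrence P n = (a : Fin (suc (suc n)) → Carrier) →
    P (suc (suc n)) a ≈ last a * P (suc n) (incrementLast n (init a)) + P (suc n) (init a)

  lastRecurrence-+ : {P Q : (k : ℕ) → (Fin k → Carrier) → Carrier} {n : ℕ} →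
    LastRecurrence P n → LastRecurrence Q n → LastRecurrence (λ k a → P k a + Q k a) n
  lastRecurrence-+ recP recQ a = trans (+-cong (recP a) (recQ a))
    (solve 5 (λ x p p′ q q′ → ((x ⊗ p ⊕ p′) ⊕ (x ⊗ q ⊕ q′)) ⊜ (x ⊗ (p ⊕ q) ⊕ (p′ ⊕ q′))) refl _ _ _ _ _)

  lastRecurrence-suc : {P Q S : (k : ℕ) → (Fin k → Carrier) → Carrier} {n : ℕ} →
    ((k : ℕ) (a : Fin (suc k) → Carrier) → P (suc k) a ≈ Q k (tail a) + a zero * S k (tail a)) →
    LastRecurrence Q n → LastRecurrence S n → LastRecurrence P (suc n)
  lastRecurrence-suc {P} {Q} {S} {n} expand recQ recS a = begin
    P (suc (suc (suc n))) a                           ≈⟨ expand _ a ⟩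
    Q (suc (suc n)) t + x * S (suc (suc n)) t          ≈⟨ +-cong (recQ t) (*-congˡ (recS t)) ⟩
    (y * Q (suc n) t′ + Q (suc n) t″) + x * (y * S (suc n) t′ + S (suc n) t″)
      ≈⟨ solve 6 (λ x y q q′ s s′ → ((y ⊗ q ⊕ q′) ⊕ x ⊗ (y ⊗ s ⊕ s′)) ⊜ (y ⊗ (q ⊕ x ⊗ s) ⊕ (q′ ⊕ x ⊗ s′)))
               refl x y _ _ _ _ ⟩
    y * (Q (suc n) t′ + x * S (suc n) t′) + (Q (suc n) t″ + x * S (suc n) t″)
      ≈⟨ sym (+-cong (*-congˡ (expand _ (incrementLast (suc n) (init a)))) (expand _ (init a))) ⟩
    y * P (suc (suc n)) (incrementLast (suc n) (init a)) + P (suc (suc n)) (init a) ∎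
    where
    x = a zero
    y = last a
    t = tail a
    t′ = incrementLast n (init t)
    t″ = init t

  *-distrib-1+ : (x y : Carrier) → x * (1# + y) ≈ x + x * y
  *-distrib-1+ x y = trans (distribˡ x 1# y) (+-congʳ (*-identityʳ x))

  *-distrib-+1 : (x y : Carrier) → x * (y + 1#) ≈ x * y + x
  *-distrib-+1 x y = trans (distribˡ x y 1#) (+-congˡ (*-identityʳ x))

  L-lastRecurrence-base : LastRecurrence (L R) 0
  L-lastRecurrence-base a = begin
    L R 2 a                              ≈⟨ L-suc 1 a ⟩
    L R 1 (tail a) + x * ∂L 1 (tail a)   ≈⟨ +-cong (L-one (tail a)) (*-congˡ (∂L-one (tail a))) ⟩
    y + x * (1# + y)                     ≈⟨ +-congˡ (*-distrib-1+ x y) ⟩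
    y + (x + x * y)                      ≈⟨ solve 2 (λ x y → (y ⊕ (x ⊕ x ⊗ y)) ⊜ ((y ⊗ x ⊕ y) ⊕ x)) refl x y ⟩
    (y * x + y) + x                      ≈⟨ +-congʳ (sym (*-distrib-+1 y x)) ⟩
    y * (x + 1#) + x
      ≈⟨ sym (+-cong (*-congˡ (L-one (incrementLast 0 (init a)))) (L-one (init a))) ⟩
    y * L R 1 (incrementLast 0 (init a)) + L R 1 (init a) ∎
    where
    x = a zero
    y = last a

  ∂L-lastRecurrence-base : LastRecurrence ∂L 0
  ∂L-lastRecurrence-base a = begin
    ∂L 2 a                                                ≈⟨ ∂L-suc 1 a ⟩
    (∂L 1 (tail a) + L R 1 (tail a)) + x * ∂L 1 (tail a)
      ≈⟨ +-cong (+-cong (∂L-one (tail a)) (L-one (tail a))) (*-congˡ (∂L-one (tail a))) ⟩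
    ((1# + y) + y) + x * (1# + y)                         ≈⟨ +-congˡ (*-distrib-1+ x y) ⟩
    ((1# + y) + y) + (x + x * y)
      -- the solver cannot identify constants of an arbitrary ring, but 1# occurs only additively
      ≈⟨ solve 3 (λ o x y → (((o ⊕ y) ⊕ y) ⊕ (x ⊕ x ⊗ y)) ⊜ ((y ⊕ (y ⊗ x ⊕ y)) ⊕ (o ⊕ x))) refl 1# x y ⟩
    (y + (y * x + y)) + (1# + x)
      ≈⟨ +-congʳ (sym (trans (*-distrib-1+ y (x + 1#)) (+-congˡ (*-distrib-+1 y x)))) ⟩
    y * (1# + (x + 1#)) + (1# + x)
      ≈⟨ sym (+-cong (*-congˡ (∂L-one (incrementLast 0 (init a)))) (∂L-one (init a))) ⟩
    y * ∂L 1 (incrementLast 0 (init a)) + ∂L 1 (init a) ∎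
    where
    x = a zero
    y = last a

  L-lastRecurrence : (n : ℕ) → LastRecurrence (L R) n
  ∂L-lastRecurrence : (n : ℕ) → LastRecurrence ∂L n

  L-lastRecurrence 0       = L-lastRecurrence-base
  L-lastRecurrence (suc n) =
    lastRecurrence-suc {P = L R} {Q = L R} {S = ∂L} L-suc (L-lastRecurrence n) (∂L-lastRecurrence n)

  ∂L-lastRecurrence 0       = ∂L-lastRecurrence-base
  ∂L-lastRecurrence (suc n) =
    lastRecurrence-suc {P = ∂L} {Q = λ k a → ∂L k a + L R k a} {S = ∂L} ∂L-suc
      (lastRecurrence-+ {P = ∂L} {Q = L R} (∂L-lastRecurrence n) (L-lastRecurrence n))
      (∂L-lastRecurrence n)

lemma5p15 : {c ℓ : Level} (R : CommutativeRing c ℓ) → let open CommutativeRing R in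
    (n : ℕ) (a : Fin (suc (suc n)) → Carrier) →
      L R (suc (suc n)) a ≈ (last a * L R (suc n) (updateAt (init a) (fromℕ n) (λ x → x + 1#))) + L R (suc n) (init a)
lemma5p15 R = L-lastRecurrence R
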